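{- Let $\mathcal{A}$ be a $\mathbf{tDL}$-algebra, $X\subseteq A$ non-empty, and for $p\in\omega$ let $D_p(X)=\{y\in A:\text{there are } n\in\mathbb{N} \text{ and } x_1,\dots,x_n\in X \text{ with } d^p(\bigwedge_{i=1}^n x_i)\le y\}$. Let $\mathcal{D}=\{D_p(X)\}_{p\in\omega}$. Then: (1) $\mathcal{D}$ is an increasing chain of lattice filters of $A$; (2) $\bigcup\mathcal{D}$ is a tense filter of $\mathcal{A}$; (3) $\bigcup\mathcal{D}$ equals the tense filter generated by $X$ (the least tense filter containing $X$).
   Context: A $\mathbf{tDL}$-algebra is a bounded distributive lattice $\langle A,\wedge,\vee,0,1\rangle$ with unary operators $\mathbf{G},\mathbf{H},\mathbf{F},\mathbf{P}$ such that for all $x,y$: $\mathbf{G}1=\mathbf{H}1=1$; $\mathbf{G},\mathbf{H}$ preserve $\wedge$; $x\le\mathbf{G}\mathbf{P}x$, $x\le\mathbf{H}\mathbf{F}x$; $\mathbf{G}(x\vee y)\le\mathbf{G}x\vee\mathbf{F}y$, $\mathbf{H}(x\vee y)\le\mathbf{H}x\vee\mathbf{P}y$; $\mathbf{F}0=\mathbf{P}0=0$; $\mathbf{F},\mathbf{P}$ preserve $\vee$; $\mathbf{P}\mathbf{G}x\le x$, $\mathbf{F}\mathbf{H}x\le x$; $\mathbf{G}x\wedge\mathbf{F}y\le\mathbf{F}(x\wedge y)$, $\mathbf{H}x\wedge\mathbf{P}y\le\mathbf{P}(x\wedge y)$. $dx=\mathbf{G}x\wedge x\wedge\mathbf{H}x$,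 $d^0x=x$, $d^{n+1}x=d(d^nx)$. A tense filter is a lattice filter $S$ with $\mathbf{G}x,\mathbf{H}x\in S$ for all $x\in S$. -}

module Defs where

open import Level using (Level; _⊔_) renaming (suc to lsuc)
open import Data.Nat using (ℕ; zero; suc)
open import Data.List using (List; foldr)
open import Data.List.Relation.Unary.All using (All)
open import Data.Product using (Σ; ∃; _×_; _,_)
open import Relation.Unary using (Pred; _∈_; _⊆_)
open import Algebra.Core using (Op₁; Op₂)
open import Algebra.Lattice.Bundles using (DistributiveLattice)

record TDLAlgebra (c ℓ : Level) : Set (lsuc (c ⊔ ℓ)) where
  field
    distributiveLattice : DistributiveLattice c ℓ
  open DistributiveLattice distributiveLattice public
  infix 4 _≤_
  _≤_ : Carrier → Carrier → Set ℓ
  x ≤ y = (x ∧ y) ≈ x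
  field
    ⊥ ⊤ : Carrier
    ∨-identityʳ : ∀ x → (x ∨ ⊥) ≈ x
    ∧-identityʳ : ∀ x → (x ∧ ⊤) ≈ x
    G H F P : Op₁ Carrier
    G-cong : ∀ {x y} → x ≈ y → G x ≈ G y
    H-cong : ∀ {x y} → x ≈ y → H x ≈ H y
    F-cong : ∀ {x y} → x ≈ y → F x ≈ F y
    P-cong : ∀ {x y} → x ≈ y → P x ≈ P y
    G⊤ : G ⊤ ≈ ⊤
    H⊤ : H ⊤ ≈ ⊤
    G-∧ : ∀ x y → G (x ∧ y) ≈ (G x ∧ G y)
    H-∧ : ∀ x y → H (x ∧ y) ≈ (H x ∧ H y)
    x≤GPx : ∀ x → x ≤ G (P x)
    x≤HFx : ∀ x → x ≤ H (F x)
    G-∨ : ∀ x y → G (x ∨ y) ≤ (G x ∨ F y)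
    H-∨ : ∀ x y → H (x ∨ y) ≤ (H x ∨ P y)
    F⊥ : F ⊥ ≈ ⊥
    P⊥ : P ⊥ ≈ ⊥
    F-∨ : ∀ x y → F (x ∨ y) ≈ (F x ∨ F y)
    P-∨ : ∀ x y → P (x ∨ y) ≈ (P x ∨ P y)
    PGx≤x : ∀ x → P (G x) ≤ x
    FHx≤x : ∀ x → F (H x) ≤ x
    G-F-∧ : ∀ x y → (G x ∧ F y) ≤ F (x ∧ y)
    H-P-∧ : ∀ x y → (H x ∧ P y) ≤ P (x ∧ y)

module TDLNotions {c ℓ : Level} (𝒜 : TDLAlgebra c ℓ) where
  open TDLAlgebra 𝒜

  d : Op₁ Carrier
  d x = (G x ∧ x) ∧ H x

  d^ : ℕ → Op₁ Carrier
  d^ zero x = x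
  d^ (suc p) x = d (d^ p x)

  ⋀ : List Carrier → Carrier
  ⋀ = foldr _∧_ ⊤

  record IsFilter {r : Level} (S : Pred Carrier r) : Set (c ⊔ ℓ ⊔ r) where
    field
      nonempty : ∃ λ x → x ∈ S
      upward   : ∀ {x y} → x ∈ S → x ≤ y → y ∈ S
      ∧-closed : ∀ {x y} → x ∈ S → y ∈ S → (x ∧ y) ∈ S

  record IsTenseFilter {r : Level} (S : Pred Carrier r) : Set (c ⊔ ℓ ⊔ r) where
    field
      isFilter : IsFilter S
      G-closed : ∀ {x} → x ∈ S → G x ∈ S
      H-closed : ∀ {x} → x ∈ S → H x ∈ S

  D : {r : Level} → Pred Carrier r → ℕ → Pred Carrier (c ⊔ ℓ ⊔ r)
  D X p y = Σ (List Carrier) λ xs → All (_∈ X) xs × (d^ p (⋀ xs) ≤ y)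

  ⋃D : {r : Level} → Pred Carrier r → Pred Carrier (c ⊔ ℓ ⊔ r)
  ⋃D X y = ∃ λ p → D X p y

{-# OPTIONS --safe #-}
module Submission where

-- d is deflationary and lies below G and H, so each D_p is a filter, the D_p
-- increase with p, and applying G or H to a member of D_p lands in D_{p+1};
-- hence ⋃ D_p is a tense filter. Conversely a tense filter containing X
-- contains every finite meet of X and is closed under d, hence under d^p.

open import Defs
open import Level using (Level; _⊔_)
open import Data.Nat using (ℕ; zero; suc; _+_; _≤′_; ≤′-reflexive; ≤′-step)
open import Data.Nat.Properties using (m≤′m+n; n≤′m+n)
open import Data.Product using (∃; _×_; _,_; proj₂)
open import Data.List using (List; []; _∷_; _++_)
open import Data.List.Relation.Unary.All as All using (All; []; _∷_)
open import Data.List.Relation.Unary.All.Properties using (++⁺)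
open import Relation.Binary.PropositionalEquality using (refl)
open import Relation.Unary using (Pred; _∈_; _⊆_)
open import Algebra.Core using (Op₁)
open import Relation.Binary.Lattice using (MeetSemilattice)
open import Algebra.Lattice.Properties.Lattice using (∧-orderTheoreticMeetSemilattice)
import Relation.Binary.Lattice.Properties.MeetSemilattice as MeetSemilatticeProperties
import Relation.Binary.Reasoning.Setoid as SetoidReasoning

module TDLProperties {c ℓ : Level} (𝒜 : TDLAlgebra c ℓ) where
  open TDLAlgebra 𝒜
  open TDLNotions 𝒜

  -- The library orders a lattice by x ≈ x ∧ y; the order of TDLAlgebra is its
  -- symmetric form x ∧ y ≈ x, so each fact below is a library fact up to sym.
  private
    M : MeetSemilattice c ℓ ℓ
    M = ∧-orderTheoreticMeetSemilattice lattice
    module M = MeetSemilattice M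
    module MP = MeetSemilatticeProperties M

  ≤-refl : ∀ {x} → x ≤ x
  ≤-refl = sym M.refl

  ≤-trans : ∀ {x y z} → x ≤ y → y ≤ z → x ≤ z
  ≤-trans p q = sym (M.trans (sym p) (sym q))

  x∧y≤x : ∀ x y → x ∧ y ≤ x
  x∧y≤x x y = sym (M.x∧y≤x x y)

  x∧y≤y : ∀ x y → x ∧ y ≤ y
  x∧y≤y x y = sym (M.x∧y≤y x y)

  ∧-greatest : ∀ {x y z} → x ≤ y → x ≤ z → x ≤ y ∧ z
  ∧-greatest p q = sym (M.∧-greatest (sym p) (sym q))

  ∧-mono : ∀ {x y u v} → x ≤ y → u ≤ v → x ∧ u ≤ y ∧ v
  ∧-mono p q = sym (MP.∧-monotonic (sym p) (sym q))

  x≤⊤ : ∀ x → x ≤ ⊤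
  x≤⊤ = ∧-identityʳ

  ∧-homomorphic⇒mono : (f : Op₁ Carrier) → (∀ x y → f (x ∧ y) ≈ f x ∧ f y) →
                       (∀ {x y} → x ≈ y → f x ≈ f y) → ∀ {x y} → x ≤ y → f x ≤ f y
  ∧-homomorphic⇒mono f f-∧ f-cong {x} {y} x≤y = begin
    f x ∧ f y ≈⟨ sym (f-∧ x y) ⟩
    f (x ∧ y) ≈⟨ f-cong x≤y ⟩
    f x       ∎
    where open SetoidReasoning setoid

  G-mono : ∀ {x y} → x ≤ y → G x ≤ G y
  G-mono = ∧-homomorphic⇒mono G G-∧ G-cong

  H-mono : ∀ {x y} → x ≤ y → H x ≤ H y
  H-mono = ∧-homomorphic⇒mono H H-∧ H-cong

  d-mono : ∀ {x y} → x ≤ y → d x ≤ d y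
  d-mono x≤y = ∧-mono (∧-mono (G-mono x≤y) x≤y) (H-mono x≤y)

  d^-mono : ∀ p {x y} → x ≤ y → d^ p x ≤ d^ p y
  d^-mono zero    x≤y = x≤y
  d^-mono (suc p) x≤y = d-mono (d^-mono p x≤y)

  dx≤x : ∀ x → d x ≤ x
  dx≤x x = ≤-trans (x∧y≤x _ _) (x∧y≤y _ _)

  dx≤Gx : ∀ x → d x ≤ G x
  dx≤Gx x = ≤-trans (x∧y≤x _ _) (x∧y≤x _ _)

  dx≤Hx : ∀ x → d x ≤ H x
  dx≤Hx x = x∧y≤y _ _

  ⋀-++-≤ˡ : ∀ xs ys → ⋀ (xs ++ ys) ≤ ⋀ xs
  ⋀-++-≤ˡ []       ys = x≤⊤ _
  ⋀-++-≤ˡ (x ∷ xs) ys = ∧-mono ≤-refl (⋀-++-≤ˡ xs ys)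

  ⋀-++-≤ʳ : ∀ xs ys → ⋀ (xs ++ ys) ≤ ⋀ ys
  ⋀-++-≤ʳ []       ys = ≤-refl
  ⋀-++-≤ʳ (x ∷ xs) ys = ≤-trans (x∧y≤y _ _) (⋀-++-≤ʳ xs ys)

  module _ {r : Level} {S : Pred Carrier r} where

    ⊤∈filter : IsFilter S → ⊤ ∈ S
    ⊤∈filter isFilter = upward (nonempty .proj₂) (x≤⊤ _)
      where open IsFilter isFilter

    ⋀∈filter : IsFilter S → ∀ {xs} → All (_∈ S) xs → ⋀ xs ∈ S
    ⋀∈filter isFilter []         = ⊤∈filter isFilter
    ⋀∈filter isFilter (x∈S ∷ xs) = IsFilter.∧-closed isFilter x∈S (⋀∈filter isFilter xs)

    d^∈tenseFilter : IsTenseFilter S → ∀ p {x} → x ∈ S → d^ p x ∈ S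
    d^∈tenseFilter T zero    x∈S = x∈S
    d^∈tenseFilter T (suc p) x∈S = ∧-closed (∧-closed (G-closed y∈S) y∈S) (H-closed y∈S)
      where
      open IsTenseFilter T
      open IsFilter isFilter
      y∈S = d^∈tenseFilter T p x∈S

  module _ (X : Pred Carrier (c ⊔ ℓ)) where

    D-isFilter : ∀ p → IsFilter (D X p)
    D-isFilter p = record
      { nonempty = ⊤ , [] , [] , x≤⊤ _
      ; upward   = λ { (xs , xs∈X , q) y≤z → xs , xs∈X , ≤-trans q y≤z }
      ; ∧-closed = λ { (xs , xs∈X , q) (ys , ys∈X , r) → xs ++ ys , ++⁺ xs∈X ys∈X ,
          ∧-greatest (≤-trans (d^-mono p (⋀-++-≤ˡ xs ys)) q)
                     (≤-trans (d^-mono p (⋀-++-≤ʳ xs ys)) r) }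
      }

    D-⊆-suc : ∀ p → D X p ⊆ D X (suc p)
    D-⊆-suc p (xs , xs∈X , q) = xs , xs∈X , ≤-trans (dx≤x _) q

    D-mono : ∀ {p q} → p ≤′ q → D X p ⊆ D X q
    D-mono (≤′-reflexive refl)         = λ y∈D → y∈D
    D-mono {q = suc q} (≤′-step p≤′q) = λ y∈D → D-⊆-suc q (D-mono p≤′q y∈D)

    ⋃D-isFilter : IsFilter (⋃D X)
    ⋃D-isFilter = record
      { nonempty = ⊤ , 0 , ⊤∈filter (D-isFilter 0)
      ; upward   = λ { (p , y∈D) y≤z → p , IsFilter.upward (D-isFilter p) y∈D y≤z }
      ; ∧-closed = λ { (p , y∈D) (q , z∈D) → p + q ,
          IsFilter.∧-closed (D-isFilter (p + q)) (D-mono (m≤′m+n p q) y∈D)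
                                                 (D-mono (n≤′m+n p q) z∈D) }
      }

    ⋃D-isTenseFilter : IsTenseFilter (⋃D X)
    ⋃D-isTenseFilter = record
      { isFilter = ⋃D-isFilter
      ; G-closed = λ { (p , xs , xs∈X , q) → suc p , xs , xs∈X , ≤-trans (dx≤Gx _) (G-mono q) }
      ; H-closed = λ { (p , xs , xs∈X , q) → suc p , xs , xs∈X , ≤-trans (dx≤Hx _) (H-mono q) }
      }

    X⊆⋃D : X ⊆ ⋃D X
    X⊆⋃D {x} x∈X = 0 , x ∷ [] , x∈X ∷ [] , x∧y≤x x ⊤

    ⋃D-least : ∀ (S : Pred Carrier (c ⊔ ℓ)) → IsTenseFilter S → X ⊆ S → ⋃D X ⊆ S
    ⋃D-least S T X⊆S (p , xs , xs∈X , q) =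
      IsFilter.upward isFilter
        (d^∈tenseFilter T p (⋀∈filter isFilter (All.map X⊆S xs∈X))) q
      where open IsTenseFilter T

theorem2p29 : {c ℓ : Level} (𝒜 : TDLAlgebra c ℓ) →
    let open TDLAlgebra 𝒜 in
    let open TDLNotions 𝒜 in
    (X : Pred Carrier (c ⊔ ℓ)) → (∃ λ x → x ∈ X) →
    ((∀ p → IsFilter (D X p)) × (∀ p → D X p ⊆ D X (suc p)))
    × IsTenseFilter (⋃D X)
    × (X ⊆ ⋃D X)
    × (∀ (S : Pred Carrier (c ⊔ ℓ)) → IsTenseFilter S → X ⊆ S → ⋃D X ⊆ S)
theorem2p29 𝒜 X _ =
  (D-isFilter X , D-⊆-suc X) , ⋃D-isTenseFilter X , X⊆⋃D X , ⋃D-least X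
  where open TDLProperties 𝒜
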